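{- Let $V(n)$ denote the number of integers $a$ with $1\le a\le n$ that are regular modulo $n$. Then $$\limsup_{n\to\infty}\bigl(V(n+1)-V(n)\bigr)=+\infty\qquad\text{and}\qquad \liminf_{n\to\infty}\bigl(V(n+1)-V(n)\bigr)=-\infty.$$
   Context: For a positive integer $n$, an integer $a$ is called regular modulo $n$ if there exists an integer $x$ such that $a^{2}x\equiv a \pmod n$. $V(n)=\#\{a: 1\le a\le n,\ a \text{ regular modulo } n\}$. -}

module Defs where

open import Data.Nat using (ℕ; zero; suc; _+_; _≤_)
open import Data.Integer as ℤ using (ℤ; +_)
open import Data.Integer.Divisibility as ℤD using ()
open import Data.Product using (Σ; ∃; _×_)
open import Relation.Nullary using (¬_)

Regular : ℕ → ℤ → Set
Regular n a = ∃ λ (x : ℤ) → (+ n) ℤD.∣ (a ℤ.* a ℤ.* x ℤ.- a)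

-- CountUpTo P m k : exactly k of the integers a with 1 ≤ a ≤ m satisfy P.
data CountUpTo (P : ℕ → Set) : ℕ → ℕ → Set where
  cnt-zero : CountUpTo P zero zero
  cnt-yes  : ∀ {m k} → CountUpTo P m k → P (suc m) → CountUpTo P (suc m) (suc k)
  cnt-no   : ∀ {m k} → CountUpTo P m k → ¬ P (suc m) → CountUpTo P (suc m) k

V : ℕ → ℕ → Set
V n k = CountUpTo (λ a → Regular n (+ a)) n k

{-# OPTIONS --safe #-}
module Submission where

-- Modulo a prime every a is regular (x = 0 or x = a⁻¹), and regularity glues along coprime moduli
-- by the Chinese remainder theorem, so V(p) = p and V(3p) = 3p for primes p > 3.  If 4 ∣ n, an
-- a ≡ 2 (mod 4) is never regular (4 ∣ a² but 4 ∤ a), so V(n) ≤ 3n/4.  For a prime p ≡ 3 (mod 4),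
-- n = p gives V(n+1) ≤ 3(p+1)/4 and n = 3p − 1 gives V(n) ≤ 3(3p−1)/4: drops and rises of size
-- about p/4.  Euclid's argument applied to 4·B! − 1 yields such primes beyond every bound B.

open import Defs
open import Data.Nat.Base using (ℕ; zero; suc; _≤_; _<_; z≤n; s≤s; _!; NonZero)
import Data.Nat.Base as Nat
open import Data.Nat.Properties
import Data.Nat.Divisibility as Nat
open import Data.Nat.DivMod using (m≡m%n+[m/n]*n; [m+kn]%n≡m%n; m%n<n; %-distribˡ-*)
open import Data.Nat.Coprimality as Coprime using (Coprime; coprime-Bézout; prime⇒coprime)
open import Data.Nat.GCD using (module Bézout)
open import Data.Nat.Primality using (Prime; prime⇒irreducible; ¬prime[1]; prime?)
open import Data.Nat.Primality.Factorisation using (factorise; PrimeFactorisation)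
open import Data.Nat.ListAction using (product)
open import Data.Nat.ListAction.Properties using (∈⇒∣product)
import Data.Nat.Tactic.RingSolver as ℕ-Solver
open import Data.List.Base using ([]; _∷_)
open import Data.List.Membership.Propositional using (_∈_)
open import Data.List.Relation.Unary.Any using (here; there)
import Data.List.Relation.Unary.All as All
open import Data.Integer.Base using (+_; -_; 1ℤ)
import Data.Integer.Properties as Int
import Data.Integer.Divisibility.Signed as Int
import Data.Integer.DivMod as Int
import Data.Integer.Tactic.RingSolver as Int
open import Data.Product.Base using (∃; ∃₂; _×_; _,_)
open import Data.Sum.Base using (_⊎_; inj₁; inj₂)
open import Data.Empty using (⊥-elim)
open import Relation.Nullary using (¬_; Dec; yes; no; contradiction)
open import Relation.Nullary.Decidable using (from-yes; map′)
open import Relation.Unary using (Decidable; _⊆_)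
open import Relation.Binary.PropositionalEquality

countUpTo : ∀ {P : ℕ → Set} → Decidable P → ∀ m → ∃ (CountUpTo P m)
countUpTo P? zero = 0 , cnt-zero
countUpTo P? (suc m) with countUpTo P? m | P? (suc m)
... | k , c | yes p = suc k , cnt-yes c p
... | k , c | no ¬p = k , cnt-no c ¬p

CountUpTo-mono : ∀ {P R : ℕ → Set} {m k j} → P ⊆ R → CountUpTo P m k → CountUpTo R m j → k ≤ j
CountUpTo-mono P⊆R cnt-zero          cnt-zero          = z≤n
CountUpTo-mono P⊆R (cnt-yes c p)     (cnt-yes d r)     = s≤s (CountUpTo-mono P⊆R c d)
CountUpTo-mono P⊆R (cnt-yes c p)     (cnt-no d ¬r)     = ⊥-elim (¬r (P⊆R p))
CountUpTo-mono P⊆R (cnt-no c ¬p)     (cnt-yes d r)     = m≤n⇒m≤1+n (CountUpTo-mono P⊆R c d)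
CountUpTo-mono P⊆R (cnt-no c ¬p)     (cnt-no d ¬r)     = CountUpTo-mono P⊆R c d

CountUpTo-full : ∀ {P : ℕ → Set} m → (∀ a → P (suc a)) → CountUpTo P m m
CountUpTo-full zero    P⁺ = cnt-zero
CountUpTo-full (suc m) P⁺ = cnt-yes (CountUpTo-full m P⁺) (P⁺ m)

module Regularity where
  open import Data.Integer.Base using (_+_; _-_; _*_; ∣_∣)
  open import Data.Integer.Divisibility.Signed using (_∣_; divides)

  regular : ∀ {n a} x → + n ∣ a * a * x - a → Regular n a
  regular x n∣ = x , Int.∣⇒∣ᵤ n∣

  witness : ∀ {n a} → Regular n a → ∃ λ x → + n ∣ a * a * x - a
  witness (x , n∣) = x , Int.∣ᵤ⇒∣ n∣

  Regular-∣ : ∀ {m n a} → m Nat.∣ n → Regular n a → Regular m a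
  Regular-∣ m∣n (x , n∣) = x , Nat.∣-trans m∣n n∣

  ∣⇒regular : ∀ {n a} → + n ∣ a → Regular n a
  ∣⇒regular {n} {a} n∣a =
    regular {n} {a} (+ 0) (subst (+ n ∣_) (a*a*0-a≡-a a) (Int.∣m⇒∣-m {+ n} {a} n∣a))
    where
    a*a*0-a≡-a : ∀ a → - a ≡ a * a * + 0 - a
    a*a*0-a≡-a = Int.solve-∀

  lift-+* : ∀ d y n x m → d Nat.+ y Nat.* n ≡ x Nat.* m → + d + + y * + n ≡ + x * + m
  lift-+* d y n x m eq = begin
    + d + + y * + n        ≡⟨ cong (λ z → + d + z) (Int.pos-* y n) ⟨
    + (d Nat.+ y Nat.* n)  ≡⟨ cong +_ eq ⟩
    + (x Nat.* m)          ≡⟨ Int.pos-* x m ⟩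
    + x * + m              ∎
    where open ≡-Reasoning

  coprime⇒bézout : ∀ {m n} → Coprime m n → ∃₂ λ u v → u * + m + v * + n ≡ 1ℤ
  coprime⇒bézout {m} {n} m⊥n with coprime-Bézout m⊥n
  ... | Bézout.+- x y eq = + x , - + y , (begin
    + x * + m + - + y * + n           ≡⟨ cong (λ z → z + - + y * + n) (lift-+* 1 y n x m eq) ⟨
    + 1 + + y * + n + - + y * + n     ≡⟨ cancel (+ y) (+ n) ⟩
    1ℤ                                ∎)
    where open ≡-Reasoning
          cancel : ∀ y n → + 1 + y * n + - y * n ≡ 1ℤ
          cancel = Int.solve-∀
  ... | Bézout.-+ x y eq = - + x , + y , (begin
    - + x * + m + + y * + n           ≡⟨ cong (λ z → - + x * + m + z) (lift-+* 1 x m y n eq) ⟨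
    - + x * + m + (+ 1 + + x * + m)   ≡⟨ cancel (+ x) (+ m) ⟩
    1ℤ                                ∎)
    where open ≡-Reasoning
          cancel : ∀ x m → - x * m + (+ 1 + x * m) ≡ 1ℤ
          cancel = Int.solve-∀

  coprime⇒regular : ∀ {n a} → Coprime n a → Regular n (+ a)
  coprime⇒regular {n} {a} n⊥a with coprime⇒bézout n⊥a
  ... | u , v , un+va≡1 = regular {n} {+ a} v (divides (- (+ a * u)) (begin
    + a * + a * v - + a                    ≡⟨ factor (+ a) v ⟩
    + a * (v * + a - 1ℤ)                   ≡⟨ cong (λ z → + a * (v * + a - z)) (sym un+va≡1) ⟩
    + a * (v * + a - (u * + n + v * + a))  ≡⟨ expand (+ a) u v (+ n) ⟩
    - (+ a * u) * + n                      ∎))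
    where
    open ≡-Reasoning
    factor : ∀ a v → a * a * v - a ≡ a * (v * a - 1ℤ)
    factor = Int.solve-∀
    expand : ∀ a u v n → a * (v * a - (u * n + v * a)) ≡ - (a * u) * n
    expand = Int.solve-∀

  prime∤⇒coprime : ∀ {p a} → Prime p → ¬ p Nat.∣ a → Coprime p a
  prime∤⇒coprime p-prime p∤a (d∣p , d∣a) with prime⇒irreducible p-prime d∣p
  ... | inj₁ d≡1  = d≡1
  ... | inj₂ refl = ⊥-elim (p∤a d∣a)

  regular-mod-prime : ∀ {p} → Prime p → ∀ a → Regular p (+ a)
  regular-mod-prime {p} p-prime a with p Nat.∣? a
  ... | yes p∣a = ∣⇒regular {p} {+ a} (Int.∣ᵤ⇒∣ p∣a)
  ... | no  p∤a = coprime⇒regular (prime∤⇒coprime p-prime p∤a)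

  -- Chinese remainder theorem: glue the two witnesses with the idempotents v·n ≡ 1 (mod m), u·m ≡ 1 (mod n).
  Regular-* : ∀ {m n a} → Coprime m n → Regular m a → Regular n a → Regular (m Nat.* n) a
  Regular-* {m} {n} {a} m⊥n r s with witness {m} {a} r | witness {n} {a} s | coprime⇒bézout m⊥n
  ... | x , divides c a²x-a≡cm | y , divides d a²y-a≡dn | u , v , um+vn≡1 =
    regular {m Nat.* n} {a} (x * (v * + n) + y * (u * + m)) (divides (v * c + u * d) (begin
      a * a * (x * (v * + n) + y * (u * + m)) - a
        ≡⟨ split a x y (u * + m) (v * + n) ⟩
      v * + n * (a * a * x - a) + u * + m * (a * a * y - a) + a * (u * + m + v * + n) - a
        ≡⟨ cong₂ (λ e₁ e₂ → v * + n * e₁ + u * + m * e₂ + a * (u * + m + v * + n) - a) a²x-a≡cm a²y-a≡dn ⟩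
      v * + n * (c * + m) + u * + m * (d * + n) + a * (u * + m + v * + n) - a
        ≡⟨ cong (λ z → v * + n * (c * + m) + u * + m * (d * + n) + a * z - a) um+vn≡1 ⟩
      v * + n * (c * + m) + u * + m * (d * + n) + a * 1ℤ - a
        ≡⟨ collect a u v c d (+ m) (+ n) ⟩
      (v * c + u * d) * (+ m * + n)
        ≡⟨ cong ((v * c + u * d) *_) (Int.pos-* m n) ⟨
      (v * c + u * d) * + (m Nat.* n)
        ∎))
    where
    open ≡-Reasoning
    split : ∀ a x y e f →
            a * a * (x * f + y * e) - a ≡ f * (a * a * x - a) + e * (a * a * y - a) + a * (e + f) - a
    split = Int.solve-∀
    collect : ∀ a u v c d m n →
              v * n * (c * m) + u * m * (d * n) + a * 1ℤ - a ≡ (v * c + u * d) * (m * n)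
    collect = Int.solve-∀

  Regular∧∣²⇒∣ : ∀ {n a} → Regular n a → + n ∣ a * a → + n ∣ a
  Regular∧∣²⇒∣ {n} {a} r n∣a² with witness {n} {a} r
  ... | x , n∣a²x-a =
    subst (+ n ∣_) (cancel a x) (Int.∣m∣n⇒∣m-n {+ n} (Int.∣m⇒∣m*n {+ n} {a * a} x n∣a²) n∣a²x-a)
    where
    cancel : ∀ a x → a * a * x - (a * a * x - a) ≡ a
    cancel = Int.solve-∀

  -- A witness only matters modulo n, so a search over x < n decides regularity.
  regular? : ∀ n .{{_ : NonZero n}} a → Dec (Regular n a)
  regular? n a = map′ (λ (r , _ , n∣) → + r , n∣) reduce
                      (anyUpTo? (λ r → n Nat.∣? ∣ a * a * + r - a ∣) n)
    where
    reduce : Regular n a → ∃ λ r → r < n × n Nat.∣ ∣ a * a * + r - a ∣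
    reduce (x , n∣) = r , Int.n%ℕd<d x n , Int.∣⇒∣ᵤ {+ n} {a * a * + r - a}
      (Int.∣m+n∣n⇒∣m {+ n} {a * a * + r - a}
        (subst (+ n ∣_) split (Int.∣ᵤ⇒∣ {+ n} {a * a * x - a} n∣)) (divides (a * a * q) refl))
      where
      open ≡-Reasoning
      r = x Int.%ℕ n
      q = x Int./ℕ n
      shift : ∀ a r q n → a * a * (r + q * n) - a ≡ (a * a * r - a) + a * a * q * n
      shift = Int.solve-∀
      split : a * a * x - a ≡ (a * a * + r - a) + a * a * q * + n
      split = begin
        a * a * x - a                  ≡⟨ cong (λ y → a * a * y - a) (Int.a≡a%ℕn+[a/ℕn]*n x n) ⟩
        a * a * (+ r + q * + n) - a    ≡⟨ shift a (+ r) q (+ n) ⟩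
        (a * a * + r - a) + a * a * q * + n  ∎

open Regularity
open import Data.Nat.Base using (_+_; _*_; _%_; _/_)
open import Data.Nat.Divisibility
  using (_∣_; divides; ∣-refl; ∣-trans; n∣m*n; m∣m*n; ∣m∣n⇒∣m+n; ∣m+n∣m⇒∣n; ∣m⇒∣m*n; *-pres-∣;
         n∣m⇒m%n≡0; ∣1⇒≡1; m≤n⇒m!∣n!)

CountUpTo-≢2-mod-4 : ∀ t → CountUpTo (λ a → a % 4 ≢ 2) (t * 4) (t * 3)
CountUpTo-≢2-mod-4 zero    = cnt-zero
CountUpTo-≢2-mod-4 (suc t) =
  cnt-yes (cnt-yes (cnt-no (cnt-yes (CountUpTo-≢2-mod-4 t)
                                     (shift 1 λ ()))
                            (λ ≢2 → ≢2 ([m+kn]%n≡m%n 2 t 4)))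
                   (shift 3 λ ()))
          (shift 4 λ ())
  where
  shift : ∀ i → i % 4 ≢ 2 → (i + t * 4) % 4 ≢ 2
  shift i i≢2 eq = i≢2 (trans (sym ([m+kn]%n≡m%n i t 4)) eq)

Regular⇒≢2-mod-4 : ∀ {n} → 4 ∣ n → ∀ {a} → Regular n (+ a) → a % 4 ≢ 2
Regular⇒≢2-mod-4 {n} 4∣n {a} reg a%4≡2 =
  contradiction (trans (sym a%4≡2) (n∣m⇒m%n≡0 a 4 4∣a)) λ ()
  where
  2∣a : 2 ∣ a
  2∣a = subst (2 ∣_) (sym (trans (m≡m%n+[m/n]*n a 4) (cong (_+ a / 4 * 4) a%4≡2)))
              (∣m∣n⇒∣m+n ∣-refl (∣-trans (divides 2 refl) (n∣m*n (a / 4))))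
  4∣a : 4 ∣ a
  4∣a = Int.∣⇒∣ᵤ {+ 4} {+ a} (Regular∧∣²⇒∣ {4} {+ a} (Regular-∣ {a = + a} 4∣n reg)
          (subst (Int._∣_ (+ 4)) (Int.pos-* a a) (Int.∣ᵤ⇒∣ {+ 4} {+ (a * a)} (*-pres-∣ 2∣a 2∣a))))

V-exists : ∀ n .{{_ : NonZero n}} → ∃ (V n)
V-exists n = countUpTo (λ a → regular? n (+ a)) n

V-full : ∀ {n} → (∀ a → Regular n (+ a)) → V n n
V-full {n} regular-all = CountUpTo-full n (λ a → regular-all (suc a))

V[u*4]≤u*3 : ∀ u {k} → V (u * 4) k → k ≤ u * 3
V[u*4]≤u*3 u Vk = CountUpTo-mono (λ {a} → Regular⇒≢2-mod-4 (n∣m*n u) {a}) Vk (CountUpTo-≢2-mod-4 u)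

V-prime : ∀ {p} → Prime p → V p p
V-prime p-prime = V-full (regular-mod-prime p-prime)

V-3*prime : ∀ {p} → Prime p → 3 < p → V (3 * p) (3 * p)
V-3*prime {p} p-prime 3<p = V-full λ a →
  Regular-* {3} {p} {+ a} (Coprime.sym (prime⇒coprime p-prime 3<p))
                          (regular-mod-prime prime[3] a) (regular-mod-prime p-prime a)
  where
  prime[3] : Prime 3
  prime[3] = from-yes (prime? 3)

*-≡3-mod-4 : ∀ m n → (m * n) % 4 ≡ 3 → m % 4 ≡ 3 ⊎ n % 4 ≡ 3
*-≡3-mod-4 m n mn%4≡3 =
  residues (m % 4) (n % 4) (m%n<n m 4) (m%n<n n 4) (trans (sym (%-distribˡ-* m n 4)) mn%4≡3)
  where
  residues : ∀ r s → r < 4 → s < 4 → (r * s) % 4 ≡ 3 → r ≡ 3 ⊎ s ≡ 3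
  residues 3 s _ _ _ = inj₁ refl
  residues r 3 _ _ _ = inj₂ refl
  residues 0 0 _ _ ()
  residues 0 1 _ _ ()
  residues 0 2 _ _ ()
  residues 1 0 _ _ ()
  residues 1 1 _ _ ()
  residues 1 2 _ _ ()
  residues 2 0 _ _ ()
  residues 2 1 _ _ ()
  residues 2 2 _ _ ()
  residues (suc (suc (suc (suc _)))) _ (s≤s (s≤s (s≤s (s≤s ())))) _ _
  residues _ (suc (suc (suc (suc _)))) _ (s≤s (s≤s (s≤s (s≤s ())))) _

product≡3-mod-4 : ∀ xs → product xs % 4 ≡ 3 → ∃ λ q → q ∈ xs × q % 4 ≡ 3
product≡3-mod-4 []       ()
product≡3-mod-4 (x ∷ xs) prod%4≡3 with *-≡3-mod-4 x (product xs) prod%4≡3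
... | inj₁ x%4≡3 = x , here refl , x%4≡3
... | inj₂ rest%4≡3 with product≡3-mod-4 xs rest%4≡3
...   | q , q∈xs , q%4≡3 = q , there q∈xs , q%4≡3

prime-factor≡3-mod-4 : ∀ f → ∃ λ q → Prime q × q ∣ 3 + f * 4 × q % 4 ≡ 3
prime-factor≡3-mod-4 f =
  let q , q∈ , q%4≡3 = product≡3-mod-4 factors
                         (subst (λ m → m % 4 ≡ 3) isFactorisation ([m+kn]%n≡m%n 3 f 4))
  in  q , All.lookup factorsPrime q∈ , subst (q ∣_) (sym isFactorisation) (∈⇒∣product q∈) , q%4≡3
  where open PrimeFactorisation (factorise (3 + f * 4))

prime∣4F-1⇒∤F : ∀ {q} f → Prime q → q ∣ 3 + f * 4 → ¬ q ∣ suc f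
prime∣4F-1⇒∤F {q} f q-prime q∣4F-1 q∣F =
  ¬prime[1] (subst Prime (∣1⇒≡1 (∣m+n∣m⇒∣n q∣4F q∣4F-1)) q-prime)
  where
  q∣4F : q ∣ 3 + f * 4 + 1
  q∣4F = subst (q ∣_) (+-comm 1 (3 + f * 4)) (∣m⇒∣m*n 4 q∣F)

prime∣B! : ∀ B {q} → Prime q → q ≤ B → q ∣ B !
prime∣B! B {suc q} _ q≤B = ∣-trans (m∣m*n (q !)) (m≤n⇒m!∣n! q≤B)

prime≡3-mod-4-above : ∀ B → ∃ λ q → B < q × Prime q × q % 4 ≡ 3
prime≡3-mod-4-above B with B ! | 1≤n! B | prime∣B! B
... | suc f | _ | ∣F with prime-factor≡3-mod-4 f
...   | q , q-prime , q∣4F-1 , q%4≡3 =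
  q , ≰⇒> (λ q≤B → prime∣4F-1⇒∤F f q-prime q∣4F-1 (∣F q-prime q≤B)) , q-prime , q%4≡3

prime-3+t*4-above : ∀ B → ∃ λ t → B < t × Prime (3 + t * 4)
prime-3+t*4-above B with prime≡3-mod-4-above (3 + B * 4)
... | q , 3+B*4<q , q-prime , q%4≡3 = q / 4 , B<t , subst Prime q≡3+t*4 q-prime
  where
  q≡3+t*4 : q ≡ 3 + q / 4 * 4
  q≡3+t*4 = trans (m≡m%n+[m/n]*n q 4) (cong (_+ q / 4 * 4) q%4≡3)
  B<t : B < q / 4
  B<t = *-cancelʳ-< 4 B (q / 4)
          (+-cancelˡ-< 3 (B * 4) (q / 4 * 4) (subst (3 + B * 4 <_) q≡3+t*4 3+B*4<q))

V-JumpsUp : ℕ → ℕ → Set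
V-JumpsUp M N = ∃ λ n → N ≤ n × 1 ≤ n × ∃ λ k₁ → ∃ λ k₂ → V n k₁ × V (suc n) k₂ × k₁ + M ≤ k₂

V-JumpsDown : ℕ → ℕ → Set
V-JumpsDown M N = ∃ λ n → N ≤ n × 1 ≤ n × ∃ λ k₁ → ∃ λ k₂ → V n k₁ × V (suc n) k₂ × k₂ + M ≤ k₁

V-JumpsUp-anti : ∀ {M N M′ N′} → M′ ≤ M → N′ ≤ N → V-JumpsUp M N → V-JumpsUp M′ N′
V-JumpsUp-anti M′≤M N′≤N (n , N≤n , 1≤n , k₁ , k₂ , Vn , Vn+1 , k₁+M≤k₂) =
  n , ≤-trans N′≤N N≤n , 1≤n , k₁ , k₂ , Vn , Vn+1 , ≤-trans (+-monoʳ-≤ k₁ M′≤M) k₁+M≤k₂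

V-JumpsDown-anti : ∀ {M N M′ N′} → M′ ≤ M → N′ ≤ N → V-JumpsDown M N → V-JumpsDown M′ N′
V-JumpsDown-anti M′≤M N′≤N (n , N≤n , 1≤n , k₁ , k₂ , Vn , Vn+1 , k₂+M≤k₁) =
  n , ≤-trans N′≤N N≤n , 1≤n , k₁ , k₂ , Vn , Vn+1 , ≤-trans (+-monoʳ-≤ k₂ M′≤M) k₂+M≤k₁

V-JumpsDown-at-prime : ∀ t → Prime (3 + t * 4) → V-JumpsDown t t
V-JumpsDown-at-prime t p-prime =
  let k , Vk = V-exists (4 + t * 4)
  in  3 + t * 4 , ≤-trans (m≤m*n t 4) (m≤n+m (t * 4) 3) , s≤s z≤n ,
      _ , k , V-prime p-prime , Vk , (begin
        k + t          ≤⟨ +-monoˡ-≤ t (V[u*4]≤u*3 (suc t) Vk) ⟩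
        3 + t * 3 + t  ≡⟨ ℕ-Solver.solve (t ∷ []) ⟩
        3 + t * 4      ∎)
  where open ≤-Reasoning

V-JumpsUp-before-3*prime : ∀ t → 0 < t → Prime (3 + t * 4) → V-JumpsUp t t
V-JumpsUp-before-3*prime t 0<t p-prime =
  -- n = 3p − 1 for p = 3 + 4t: 4 ∣ n, while n + 1 = 3p
  let k , Vk = V-exists ((2 + t * 3) * 4)
  in  (2 + t * 3) * 4 , t≤n , s≤s z≤n ,
      k , _ , Vk , subst (λ m → V m m) 3*p≡n+1 (V-3*prime p-prime 3<p) , (begin
        k + t                             ≤⟨ +-monoˡ-≤ t (V[u*4]≤u*3 (2 + t * 3) Vk) ⟩
        (2 + t * 3) * 3 + t               ≤⟨ m≤m+n _ (3 + t * 2) ⟩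
        (2 + t * 3) * 3 + t + (3 + t * 2) ≡⟨ ℕ-Solver.solve (t ∷ []) ⟩
        suc ((2 + t * 3) * 4)             ∎)
  where
  open ≤-Reasoning
  t≤n : t ≤ (2 + t * 3) * 4
  t≤n = ≤-trans (m≤m*n t 3) (≤-trans (m≤n+m (t * 3) 2) (m≤m*n (2 + t * 3) 4))
  3<p : 3 < 3 + t * 4
  3<p = m<m+n 3 (<-≤-trans 0<t (m≤m*n t 4))
  3*p≡n+1 : 3 * (3 + t * 4) ≡ suc ((2 + t * 3) * 4)
  3*p≡n+1 = ℕ-Solver.solve (t ∷ [])

proposition3 :
    (∀ (M N : ℕ) → ∃ λ n → N ≤ n × 1 ≤ n × ∃ λ k₁ → ∃ λ k₂ →
        V n k₁ × V (suc n) k₂ × k₁ + M ≤ k₂)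
    × (∀ (M N : ℕ) → ∃ λ n → N ≤ n × 1 ≤ n × ∃ λ k₁ → ∃ λ k₂ →
        V n k₁ × V (suc n) k₂ × k₂ + M ≤ k₁)
proposition3 = jumpsUp , jumpsDown
  where
  jumpsUp : ∀ M N → V-JumpsUp M N
  jumpsUp M N =
    let t , M+N<t , p-prime = prime-3+t*4-above (M + N)
    in  V-JumpsUp-anti (m+n≤o⇒m≤o M (<⇒≤ M+N<t)) (m+n≤o⇒n≤o M (<⇒≤ M+N<t))
          (V-JumpsUp-before-3*prime t (≤-<-trans z≤n M+N<t) p-prime)
  jumpsDown : ∀ M N → V-JumpsDown M N
  jumpsDown M N =
    let t , M+N<t , p-prime = prime-3+t*4-above (M + N)
    in  V-JumpsDown-anti (m+n≤o⇒m≤o M (<⇒≤ M+N<t)) (m+n≤o⇒n≤o M (<⇒≤ M+N<t))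
          (V-JumpsDown-at-prime t p-prime)
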